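{- Let $P = P[0]P[1]\cdots P[N-1]$ be a balanced sequence of parentheses, and define the excess $E(k)$, for $0 \le k < N$, as the number of open parentheses minus the number of closed parentheses among $P[0], \dots, P[k]$; set $E(-1)=0$. Partition the positions $0,\dots,N-1$ into consecutive blocks $\mathcal{B}_0, \mathcal{B}_1, \dots$ (each block a set of consecutive positions, blocks ordered left to right). Let $i$ be the position of an open parenthesis, and let $x = E(i-1)$ be the target value (the excess just before position $i$). For each block $\mathcal{B}_j$ containing at least one position $>i$, let $m_j = \min\{E(k) : k \in \mathcal{B}_j,\ k > i\}$ and $M_j = \max\{E(k) : k \in \mathcal{B}_j,\ k > i\}$. Define the Range Min-Max forward search result as the smallest index $j$ (among such blocks) with $m_j \le x \le M_j$, and the Range Min forward search result as the smallest index $j$ (among such blocks) with $m_j \le x$. Then both searches are well defined and return the same block index $j$; moreover this block is the one containing the matching closed parenthesis (the mate) of position $i$.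
   Context: A sequence of parentheses is balanced if it is a well-formed parenthesization (every prefix has nonnegative excess and the total excess is $0$). The mate of an open parenthesis at position $i$ is the position $c>i$ of its matching closed parenthesis, i.e. the first position $c>i$ with $E(c)=E(i-1)$. The Range Min-Max tree answers forward search by finding the first block (after the query position) whose minimum and maximum cumulative excess bracket the target value; the Range Min tree stores only block minima and finds the first block whose minimum is at most the target value. -}

module Defs where

open import Data.Bool using (Bool; true; false)
open import Data.Nat using (ℕ; zero; suc; _<_; _+_) renaming (_≤_ to _≤ℕ_)
open import Data.Integer using (ℤ; +_; _⊓_; _⊔_; _≤_) renaming (_+_ to _+ℤ_)
import Data.Integer as ℤ
open import Data.List using (List; []; _∷_; take; length; foldr; map; filter; applyUpTo)
open import Data.List.Membership.Propositional using (_∈_)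
open import Data.Maybe using (Maybe; just; nothing)
open import Data.Product using (Σ; ∃; _×_; _,_)
open import Relation.Binary.PropositionalEquality using (_≡_; _≢_)
open import Relation.Nullary using (¬_)
import Data.Nat as ℕ
import Data.Nat.ListAction

-- A parenthesis sequence: true = '(' (open), false = ')' (closed).
Parens : Set
Parens = List Bool

step : Bool → ℤ
step true  = + 1
step false = ℤ.-1ℤ

exc : Parens → ℤ
exc []       = + 0
exc (b ∷ bs) = step b +ℤ exc bs

E : Parens → ℕ → ℤ
E P k = exc (take (suc k) P)

-- Eprev P i = E(i-1) = excess of P[0..i-1]  (so Eprev P 0 = E(-1) = 0)
Eprev : Parens → ℕ → ℤ
Eprev P i = exc (take i P)

Balanced : Parens → Set
Balanced P = (∀ n → + 0 ≤ exc (take n P)) × exc P ≡ + 0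

IsMate : Parens → ℕ → ℕ → Set
IsMate P i c = i < c × c < length P × E P c ≡ Eprev P i
             × (∀ k → i < k → k < c → E P k ≢ Eprev P i)

-- A partition into consecutive blocks is given by the list of block lengths
-- (each positive, summing to N).  blocks s ls lists the positions of each block,
-- the first block starting at position s.
blocks : ℕ → List ℕ → List (List ℕ)
blocks s []       = []
blocks s (l ∷ ls) = applyUpTo (λ k → s + k) l ∷ blocks (s + l) ls

nth : List (List ℕ) → ℕ → List ℕ
nth []         _       = []
nth (b ∷ bs)   zero    = b
nth (b ∷ bs)   (suc j) = nth bs j

-- positions of block B_j (empty list if j is out of range)
Block : List ℕ → ℕ → List ℕ
Block ls j = nth (blocks 0 ls) j

data AllPos : List ℕ → Set where
  []  : AllPos []
  _∷_ : ∀ {l ls} → 1 ≤ℕ l → AllPos ls → AllPos (l ∷ ls)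

IsBlockPartition : ℕ → List ℕ → Set
IsBlockPartition N ls = AllPos ls × Data.Nat.ListAction.sum ls ≡ N

listMin : List ℤ → Maybe ℤ
listMin []       = nothing
listMin (e ∷ es) = just (foldr _⊓_ e es)

listMax : List ℤ → Maybe ℤ
listMax []       = nothing
listMax (e ∷ es) = just (foldr _⊔_ e es)

blockVals : Parens → List ℕ → ℕ → ℕ → List ℤ
blockVals P ls i j = map (E P) (filter (i ℕ.<?_) (Block ls j))

-- m_j and M_j (defined iff B_j contains a position > i)
mBlock : Parens → List ℕ → ℕ → ℕ → Maybe ℤ
mBlock P ls i j = listMin (blockVals P ls i j)

MBlock : Parens → List ℕ → ℕ → ℕ → Maybe ℤ
MBlock P ls i j = listMax (blockVals P ls i j)

RMMcond : Parens → List ℕ → ℕ → ℤ → ℕ → Set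
RMMcond P ls i x j = Σ ℤ λ m → Σ ℤ λ M →
  mBlock P ls i j ≡ just m × MBlock P ls i j ≡ just M × m ≤ x × x ≤ M

RMcond : Parens → List ℕ → ℕ → ℤ → ℕ → Set
RMcond P ls i x j = Σ ℤ λ m → mBlock P ls i j ≡ just m × m ≤ x

IsLeast : (ℕ → Set) → ℕ → Set
IsLeast C j = C j × (∀ j' → j' < j → ¬ C j')

module Submission where

-- Write x = E(i-1).  Reading one parenthesis changes the prefix excess by ±1,
-- so the prefix excess is a function ℕ → ℤ that never drops by more than one
-- per step.  It exceeds x just after the open parenthesis at i and is back at
-- 0 ≤ x at the end of the balanced sequence, so by a discrete intermediate
-- value argument there is a first position c > i with E(c) = x, and the excess
-- stays strictly above x on (i, c): c is the mate of i.  Let B_j be the block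
-- holding c.  Then m_j ≤ E(c) = x ≤ M_j, so both searches accept B_j; every
-- earlier block only holds positions < c, whose excess (when > i) is above x,
-- so its minimum is above x and neither search accepts it.

open import Defs
open import Data.Bool using (true; false)
open import Data.Nat using (ℕ; zero; suc; z≤n; s≤s; _∸_) renaming (_+_ to _+ℕ_; _<_ to _<ℕ_; _≤_ to _≤ℕ_)
import Data.Nat as ℕ
import Data.Nat.Properties as ℕP
open import Data.Nat.ListAction using (sum)
open import Data.Fin using (Fin; toℕ)
import Data.Fin as Fin
open import Data.Fin.Properties using (toℕ<n)
open import Data.List using (List; []; _∷_; length; lookup; take; foldr; filter; applyUpTo)
open import Data.List.Properties using (take-all)
open import Data.List.Membership.Propositional using (_∈_)
open import Data.List.Membership.Propositional.Properties
  using (∈-map⁺; ∈-map⁻; ∈-filter⁺; ∈-filter⁻; ∈-applyUpTo⁺; ∈-applyUpTo⁻)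
open import Data.List.Relation.Unary.Any using (here; there)
open import Data.Integer using (ℤ; -≤+; _⊓_; _⊔_; _≤_; _<_; pred; 1ℤ) renaming (_+_ to _+ℤ_; suc to sucℤ)
open import Data.Integer.Properties
open import Algebra.Properties.CommutativeSemigroup +-commutativeSemigroup using (x∙yz≈y∙xz)
open import Data.Maybe using (just)
open import Data.Product using (Σ; _×_; _,_)
open import Data.Sum using (inj₁; inj₂)
open import Data.Empty using (⊥-elim)
open import Function using (_∘_)
open import Relation.Nullary using (¬_; yes; no)
open import Relation.Binary.PropositionalEquality using (_≡_; refl; sym; trans; cong; subst)

-- Eprev P n is the excess of the first n symbols and
-- E P k = Eprev P (suc k) definitionally.

SlowDescent : (ℕ → ℤ) → Set
SlowDescent f = ∀ n → pred (f n) ≤ f (suc n)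

Eprev-slowDescent : (P : Parens) → SlowDescent (Eprev P)
Eprev-slowDescent []          zero    = -≤+
Eprev-slowDescent []          (suc n) = -≤+
Eprev-slowDescent (true ∷ _)  zero    = -≤+
Eprev-slowDescent (false ∷ _) zero    = ≤-refl
Eprev-slowDescent (b ∷ bs)    (suc n) =
  subst (_≤ step b +ℤ Eprev bs (suc n)) (+-pred (step b) (Eprev bs n))
        (+-monoʳ-≤ (step b) (Eprev-slowDescent bs n))

E-open : (P : Parens) (i : Fin (length P)) → lookup P i ≡ true →
         E P (toℕ i) ≡ sucℤ (Eprev P (toℕ i))
E-open (true ∷ _)  Fin.zero    refl = refl
E-open (b ∷ bs)    (Fin.suc i) open-i =
  trans (cong (step b +ℤ_) (E-open bs i open-i))
        (x∙yz≈y∙xz (step b) 1ℤ (Eprev bs (toℕ i)))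

FirstReturn : (ℕ → ℤ) → ℤ → ℕ → ℕ → Set
FirstReturn f x a c = a <ℕ c × f c ≡ x × (∀ k → a <ℕ k → k <ℕ c → x < f k)

firstReturn : ∀ f → SlowDescent f → ∀ x d a → x < f a → f (a +ℕ d) ≤ x →
              Σ ℕ λ c → c ≤ℕ a +ℕ d × FirstReturn f x a c
firstReturn f slow x zero a above below =
  ⊥-elim (<⇒≱ above (subst (λ n → f n ≤ x) (ℕP.+-identityʳ a) below))
firstReturn f slow x (suc d) a above below with f (suc a) ≤? x
... | yes returned = suc a , ℕP.m<m+n a (s≤s z≤n) , ℕP.≤-refl , hit , nothingBetween
  where
    hit : f (suc a) ≡ x
    hit = ≤-antisym returned (≤-trans (i<j⇒i≤pred[j] above) (slow a))
    nothingBetween : ∀ k → a <ℕ k → k <ℕ suc a → x < f k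
    nothingBetween k a<k k<1+a = ⊥-elim (ℕP.<⇒≱ a<k (ℕP.≤-pred k<1+a))
... | no stillAbove
  with firstReturn f slow x d (suc a) (≰⇒> stillAbove) (subst (λ n → f n ≤ x) (ℕP.+-suc a d) below)
... | c , c≤ , 1+a<c , hit , between =
  c , subst (c ≤ℕ_) (sym (ℕP.+-suc a d)) c≤ , ℕP.<-trans (ℕP.n<1+n a) 1+a<c , hit , between′
  where
    between′ : ∀ k → a <ℕ k → k <ℕ c → x < f k
    between′ k a<k k<c with ℕP.m≤n⇒m<n∨m≡n a<k
    ... | inj₁ 1+a<k = between k 1+a<k k<c
    ... | inj₂ refl  = ≰⇒> stillAbove

IsStrictMate : Parens → ℕ → ℕ → Set
IsStrictMate P i c = i <ℕ c × c <ℕ length P × E P c ≡ Eprev P i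
                   × (∀ k → i <ℕ k → k <ℕ c → Eprev P i < E P k)

strictMate⇒mate : ∀ {P i c} → IsStrictMate P i c → IsMate P i c
strictMate⇒mate (i<c , c<N , hit , above) =
  i<c , c<N , hit , λ k i<k k<c same → <-irrefl (sym same) (above k i<k k<c)

strictMate : (P : Parens) → Balanced P → (i : Fin (length P)) → lookup P i ≡ true →
             Σ ℕ (IsStrictMate P (toℕ i))
strictMate P (nonneg , total) i open-i
  with firstReturn (Eprev P) (Eprev-slowDescent P) x (N ∸ suc (toℕ i)) (suc (toℕ i)) afterOpen atEnd
  where
    N = length P
    x = Eprev P (toℕ i)
    afterOpen : x < Eprev P (suc (toℕ i))
    afterOpen = subst (x <_) (sym (E-open P i open-i)) (suc[i]≤j⇒i<j ≤-refl)
    atEnd : Eprev P (suc (toℕ i) +ℕ (N ∸ suc (toℕ i))) ≤ x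
    atEnd rewrite ℕP.m+[n∸m]≡n (toℕ<n i) | take-all N P ℕP.≤-refl | total = nonneg (toℕ i)
... | suc c , c+1≤N , s≤s i<c , hit , between =
  c , i<c , subst (suc c ≤ℕ_) (ℕP.m+[n∸m]≡n (toℕ<n i)) c+1≤N , hit ,
  λ k i<k k<c → between (suc k) (s≤s i<k) (s≤s k<c)

blockOf : ∀ ls s c → s ≤ℕ c → c <ℕ s +ℕ sum ls →
          Σ ℕ λ j → c ∈ nth (blocks s ls) j
                  × (∀ j′ → j′ <ℕ j → ∀ k → k ∈ nth (blocks s ls) j′ → k <ℕ c)
blockOf []       s c s≤c c<s+0 =
  ⊥-elim (ℕP.<⇒≱ c<s+0 (subst (_≤ℕ c) (sym (ℕP.+-identityʳ s)) s≤c))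
blockOf (l ∷ ls) s c s≤c c<end with c ℕ.<? s +ℕ l
... | yes c<s+l = 0 , inFirst , λ _ ()
  where
    offset<l : c ∸ s <ℕ l
    offset<l = ℕP.+-cancelˡ-< s _ _ (subst (_<ℕ s +ℕ l) (sym (ℕP.m+[n∸m]≡n s≤c)) c<s+l)
    inFirst : c ∈ applyUpTo (s +ℕ_) l
    inFirst = subst (_∈ applyUpTo (s +ℕ_) l) (ℕP.m+[n∸m]≡n s≤c) (∈-applyUpTo⁺ (s +ℕ_) offset<l)
... | no c≮s+l
  with blockOf ls (s +ℕ l) c (ℕP.≮⇒≥ c≮s+l) (subst (c <ℕ_) (sym (ℕP.+-assoc s l _)) c<end)
... | j , c∈j , earlier = suc j , c∈j , earlier′
  where
    earlier′ : ∀ j′ → j′ <ℕ suc j → ∀ k → k ∈ nth (blocks s (l ∷ ls)) j′ → k <ℕ c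
    earlier′ zero      _         k k∈first with ∈-applyUpTo⁻ (s +ℕ_) k∈first
    ... | t , t<l , refl = ℕP.<-≤-trans (ℕP.+-monoʳ-< s t<l) (ℕP.≮⇒≥ c≮s+l)
    earlier′ (suc j′) (s≤s j′<j) k k∈j′ = earlier j′ j′<j k k∈j′

foldr-⊓-≤ : ∀ a as {e} → e ∈ a ∷ as → foldr _⊓_ a as ≤ e
foldr-⊓-≤ a []       (here refl)         = ≤-refl
foldr-⊓-≤ a (b ∷ bs) (here refl)         = ≤-trans (i⊓j≤j b _) (foldr-⊓-≤ a bs (here refl))
foldr-⊓-≤ a (b ∷ bs) (there (here refl)) = i⊓j≤i b _
foldr-⊓-≤ a (b ∷ bs) (there (there e∈))  = ≤-trans (i⊓j≤j b _) (foldr-⊓-≤ a bs (there e∈))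

foldr-⊔-≥ : ∀ a as {e} → e ∈ a ∷ as → e ≤ foldr _⊔_ a as
foldr-⊔-≥ a []       (here refl)         = ≤-refl
foldr-⊔-≥ a (b ∷ bs) (here refl)         = ≤-trans (foldr-⊔-≥ a bs (here refl)) (i≤j⊔i b _)
foldr-⊔-≥ a (b ∷ bs) (there (here refl)) = i≤i⊔j b _
foldr-⊔-≥ a (b ∷ bs) (there (there e∈))  = ≤-trans (foldr-⊔-≥ a bs (there e∈)) (i≤j⊔i b _)

foldr-⊓-∈ : ∀ a as → foldr _⊓_ a as ∈ a ∷ as
foldr-⊓-∈ a []       = here refl
foldr-⊓-∈ a (b ∷ bs) with ⊓-sel b (foldr _⊓_ a bs)
... | inj₁ isB = there (here isB)
... | inj₂ isRest with foldr-⊓-∈ a bs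
...   | here isA   = here (trans isRest isA)
...   | there inBs = there (there (subst (_∈ bs) (sym isRest) inBs))

listMin-≤ : ∀ {e} L → e ∈ L → Σ ℤ λ m → listMin L ≡ just m × m ≤ e
listMin-≤ (a ∷ as) e∈ = _ , refl , foldr-⊓-≤ a as e∈

listMax-≥ : ∀ {e} L → e ∈ L → Σ ℤ λ M → listMax L ≡ just M × e ≤ M
listMax-≥ (a ∷ as) e∈ = _ , refl , foldr-⊔-≥ a as e∈

listMin-∈ : ∀ L {m} → listMin L ≡ just m → m ∈ L
listMin-∈ (a ∷ as) refl = foldr-⊓-∈ a as

RMMcond⇒RMcond : ∀ P ls i x j → RMMcond P ls i x j → RMcond P ls i x j
RMMcond⇒RMcond _ _ _ _ _ (m , _ , m≡ , _ , m≤x , _) = m , m≡ , m≤x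

RMMcond-hit : ∀ P ls i {x j c} → i <ℕ c → c ∈ Block ls j → E P c ≡ x → RMMcond P ls i x j
RMMcond-hit P ls i {x} {j} i<c c∈j hit with listMin-≤ _ Ec∈ | listMax-≥ _ Ec∈
  where
    Ec∈ : E P _ ∈ blockVals P ls i j
    Ec∈ = ∈-map⁺ (E P) (∈-filter⁺ (i ℕ.<?_) c∈j i<c)
... | m , m≡ , m≤ | M , M≡ , ≤M = m , M , m≡ , M≡ , subst (m ≤_) hit m≤ , subst (_≤ M) hit ≤M

¬RMcond-above : ∀ P ls i {x j} → (∀ k → k ∈ Block ls j → i <ℕ k → x < E P k) →
                ¬ RMcond P ls i x j
¬RMcond-above P ls i {x} {j} above (m , m≡ , m≤x) with ∈-map⁻ (E P) (listMin-∈ _ m≡)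
... | k , k∈filtered , refl with ∈-filter⁻ (i ℕ.<?_) {xs = Block ls j} k∈filtered
... | k∈j , i<k = <⇒≱ (above k k∈j i<k) m≤x

lemma1 : (P : Parens) → Balanced P →
         (ls : List ℕ) → IsBlockPartition (length P) ls →
         (i : Fin (length P)) → lookup P i ≡ true →
         Σ ℕ λ j → Σ ℕ λ c →
           IsLeast (RMMcond P ls (toℕ i) (Eprev P (toℕ i))) j
           × IsLeast (RMcond P ls (toℕ i) (Eprev P (toℕ i))) j
           × IsMate P (toℕ i) c
           × c ∈ Block ls j
lemma1 P balanced ls (_ , total) i open-i
  with strictMate P balanced i open-i
... | c , mate@(i<c , c<N , hit , above)
  with blockOf ls 0 c z≤n (subst (c <ℕ_) (sym total) c<N)
... | j , c∈j , earlier =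
  j , c , (accept , rejectRMM) , (RMMcond⇒RMcond P ls (toℕ i) x j accept , rejectRM)
        , strictMate⇒mate mate , c∈j
  where
    x = Eprev P (toℕ i)
    accept : RMMcond P ls (toℕ i) x j
    accept = RMMcond-hit P ls (toℕ i) i<c c∈j hit
    rejectRM : ∀ j′ → j′ <ℕ j → ¬ RMcond P ls (toℕ i) x j′
    rejectRM j′ j′<j = ¬RMcond-above P ls (toℕ i)
      λ k k∈j′ i<k → above k i<k (earlier j′ j′<j k k∈j′)
    rejectRMM : ∀ j′ → j′ <ℕ j → ¬ RMMcond P ls (toℕ i) x j′
    rejectRMM j′ j′<j = rejectRM j′ j′<j ∘ RMMcond⇒RMcond P ls (toℕ i) x j′
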